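{- Let $G$ be an $n$-vertex graph, $n\ge 2$, with minimum degree $\delta\ge \log_2(n)+2\log_2\log_2(n)$. Then $z(G;k)\le z(P_n;k)$ for every non-negative integer $k$.
   Context: All graphs are finite and simple; $P_n$ is the path on $n$ vertices. Zero forcing: given a graph $G$ whose vertices are each colored blue or white, if a blue vertex $u$ has exactly one white neighbor $v$, then $v$ may be recolored blue; this rule is applied repeatedly. A set $B\subseteq V(G)$ is a zero forcing set of $G$ if, starting with exactly the vertices of $B$ blue, repeated application eventually colors all of $V(G)$ blue. $z(G;k)$ denotes the number of zero forcing sets of $G$ of size exactly $k$. -}

module Defs where

open import Data.Nat using (ℕ; zero; suc; _+_; _*_; _^_; _≤_; _<_; _⊓_; _≡ᵇ_)
open import Data.Bool using (Bool; true; false; _∨_)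
open import Data.Fin using (Fin; toℕ)
import Data.Fin as Fin
open import Data.Fin.Subset using (Subset; _∈_; _∉_; ⁅_⁆; _∪_; ∣_∣)
open import Data.Vec using (tabulate)
open import Data.List using (List; foldr; allFin; length)
import Data.List.Membership.Propositional as L
open import Data.List.Relation.Unary.Unique.Propositional using (Unique)
open import Data.Product using (_×_; Σ; ∃; ∃-syntax; _,_)
open import Relation.Binary.PropositionalEquality using (_≡_; _≢_)
open import Relation.Nullary using (¬_)
open import Function.Bundles using (_⇔_)

Graph : ℕ → Set
Graph n = Fin n → Fin n → Bool

Adj : ∀ {n} → Graph n → Fin n → Fin n → Set
Adj G u v = G u v ≡ true

record IsSimple {n : ℕ} (G : Graph n) : Set where
  field
    symmetric   : ∀ u v → G u v ≡ G v u
    irreflexive : ∀ u → G u u ≡ false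

nbhd : ∀ {n} → Graph n → Fin n → Subset n
nbhd G u = tabulate (G u)

degree : ∀ {n} → Graph n → Fin n → ℕ
degree G u = ∣ nbhd G u ∣

minDegree : ∀ {n} → Graph n → ℕ
minDegree {zero}  G = 0
minDegree {suc n} G = foldr (λ v acc → degree G v ⊓ acc) (degree G Fin.zero) (allFin (suc n))

path : (n : ℕ) → Graph n
path n i j = ((suc (toℕ i)) ≡ᵇ toℕ j) ∨ ((suc (toℕ j)) ≡ᵇ toℕ i)

-- Zero forcing: B is a zero forcing set of G if, starting from B blue,
-- repeated application of the colour-change rule (a blue u with exactly one
-- white neighbour v forces v blue) eventually makes every vertex blue.
data ZeroForcing {n : ℕ} (G : Graph n) : Subset n → Set where
  done  : ∀ {B} → (∀ v → v ∈ B) → ZeroForcing G B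
  force : ∀ {B} (u v : Fin n) →
          u ∈ B → v ∉ B → Adj G u v →
          (∀ w → Adj G u w → w ≢ v → w ∈ B) →
          ZeroForcing G (B ∪ ⁅ v ⁆) → ZeroForcing G B

-- "c = z(G;k)": the list L enumerates without repetition exactly the zero
-- forcing sets of G of size k, so z(G;k) = length L.
Enumerates-ZF : ∀ {n} → Graph n → ℕ → List (Subset n) → Set
Enumerates-ZF G k L = Unique L × (∀ B → (B L.∈ L) ⇔ (ZeroForcing G B × ∣ B ∣ ≡ k))

-- Integer encoding of  d ≥ log₂ n + 2 log₂ log₂ n  (for n ≥ 2):
-- equivalently (log₂ n)² ≤ 2^d / n, i.e. every rational a/b < log₂ n
-- (i.e. 2^a < n^b) satisfies (a/b)² ≤ 2^d / n.
LogDegreeCondition : ℕ → ℕ → Set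
LogDegreeCondition n d =
  ∀ (a b : ℕ) → 1 ≤ b → 2 ^ a < n ^ b → a * a * n ≤ b * b * 2 ^ d

module Submission where

-- Sort the zero forcing k-sets of G by a first force u → v: such a set contains u and every
-- neighbour of u except v, which are deg u vertices, so for k < n
--   z(G;k) ≤ Σ_u deg u · C(n − deg u, k − deg u).
-- On the path every k-set containing the end vertex 0 is zero forcing, so z(P_n;k) ≥ C(n − 1, k − 1),
-- and when 2k ≥ n every k-set is (it contains an end vertex or two consecutive vertices).
-- If 2k < n then every e = deg u ≤ k has 2e < n, and the degree condition yields 2ne ≤ 2^e.
-- Since C(N, K) at least doubles when N and K both grow by one as long as 2(K + 1) ≤ N + 1,
-- this gives n · e · C(n − e, k − e) ≤ C(n − 1, k − 1): each vertex contributes at most a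
-- 1/n share of z(P_n;k).

open import Defs
open import Data.Nat hiding (∣_-_∣)
open import Data.Nat.Properties
open import Data.Nat.Combinatorics using (_C_; nC1≡n; nCk+nC[k+1]≡[n+1]C[k+1])
open import Data.Nat.Tactic.RingSolver using (solve-∀)
open import Data.Bool using (Bool; true; false; T; _∧_; if_then_else_)
open import Data.Bool.Properties using (T-≡; T-∧; T-∨; T?)
import Data.Bool.Properties as Bool
open import Data.Unit using (tt)
open import Data.Empty using (⊥; ⊥-elim)
open import Data.Fin using (Fin; zero; suc; toℕ; fromℕ<)
open import Data.Fin.Properties using (toℕ<n; toℕ-fromℕ<; toℕ-injective)
import Data.Fin.Properties as Fin
open import Data.Fin.Subset using (Subset; inside; outside; ∣_∣; _⊆_; _∈_; _∉_; _∪_; ⁅_⁆; _-_; ⊤)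
open import Data.Fin.Subset.Properties
  using (_∈?_; _⊆?_; ∣p∣≤n; ∣p∣≡n⇒p≡⊤; ∈⊤; ∣⊤∣≡n; ∣⁅x⁆∣≡1; p⊆q⇒∣p∣≤∣q∣; p─q⊆p; p─⊥≡p; ∪-identityʳ;
         x∈p∪q⁺; x∈p∪q⁻; x∈⁅x⁆; x∈⁅y⁆⇒x≡y)
open import Data.Vec using ([]; _∷_; tabulate)
open import Data.Vec.Properties using (∷-injectiveʳ; lookup∘tabulate; []=⇒lookup; lookup⇒[]=)
open Data.Vec._[_]=_
open import Data.List using (List; []; _∷_; [_]; _++_; map; length; filter; foldr; allFin)
open import Data.List.Membership.Propositional using () renaming (_∈_ to _∈ₗ_)
open import Data.List.Membership.Propositional.Properties
  using (∈-map⁻; ∈-map⁺; ∈-++⁻; ∈-++⁺ˡ; ∈-++⁺ʳ; ∈-allFin; ∈-filter⁺; ∈-filter⁻)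
open import Data.List.Relation.Unary.Any using (here; there)
import Data.List.Relation.Unary.All as All
open import Data.List.Relation.Unary.AllPairs using ([]; _∷_)
open import Data.List.Relation.Unary.Unique.Propositional using (Unique)
import Data.List.Relation.Unary.Unique.Propositional.Properties as Unique
open import Data.Product using (_×_; _,_; proj₁; proj₂; ∃-syntax; Σ-syntax)
import Data.Product as Product
open import Data.Sum using (_⊎_; inj₁; inj₂; [_,_]′)
import Data.Sum as Sum
open import Function using (_∘_; _∘′_)
open import Function.Bundles using (Equivalence; mk⇔)
open import Relation.Nullary using (¬_; Dec; does; yes; no; contradiction)
open import Relation.Nullary.Decidable using (map′; toWitness; _×-dec_; _⊎-dec_; _→-dec_; ¬?)
open import Relation.Binary.PropositionalEquality
  using (_≡_; _≢_; refl; sym; trans; cong; cong₂; subst; subst₂; module ≡-Reasoning)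
open import Algebra.Properties.CommutativeSemigroup *-commutativeSemigroup using (x∙yz≈y∙xz)
open import Algebra.Properties.Semiring.Sum +-*-semiring using (sum-syntax; sum-cong-≗; ∑-distrib-+; *-distribˡ-sum)
open Equivalence using (to; from)

-- Binomial coefficients

[1+k]*[1+n]C[1+k]≡[1+n]*nCk : ∀ n k → suc k * (suc n C suc k) ≡ suc n * (n C k)
[1+k]*[1+n]C[1+k]≡[1+n]*nCk zero    zero    = refl
[1+k]*[1+n]C[1+k]≡[1+n]*nCk zero    (suc k) = *-zeroʳ (2 + k)
[1+k]*[1+n]C[1+k]≡[1+n]*nCk (suc n) zero    =
  trans (+-identityʳ _) (trans (nC1≡n (2 + n)) (sym (*-identityʳ (2 + n))))
[1+k]*[1+n]C[1+k]≡[1+n]*nCk (suc n) (suc k) = begin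
  suc K * (suc N C suc K)
    ≡⟨ cong (suc K *_) (nCk+nC[k+1]≡[n+1]C[k+1] N K) ⟨
  suc K * (N C K + N C suc K)
    ≡⟨ *-distribˡ-+ (suc K) (N C K) (N C suc K) ⟩
  N C K + K * (N C K) + suc K * (N C suc K)
    ≡⟨ cong₂ (λ x y → N C K + x + y) ([1+k]*[1+n]C[1+k]≡[1+n]*nCk n k) ([1+k]*[1+n]C[1+k]≡[1+n]*nCk n K) ⟩
  N C K + N * (n C k) + N * (n C K)
    ≡⟨ +-assoc (N C K) (N * (n C k)) (N * (n C K)) ⟩
  N C K + (N * (n C k) + N * (n C K))
    ≡⟨ cong (N C K +_) (*-distribˡ-+ N (n C k) (n C K)) ⟨
  N C K + N * (n C k + n C K)
    ≡⟨ cong (λ x → N C K + N * x) (nCk+nC[k+1]≡[n+1]C[k+1] n k) ⟩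
  suc N * (N C K)
  ∎
  where
  open ≡-Reasoning
  N = suc n
  K = suc k

2*nCk≤[1+n]C[1+k] : ∀ n k → 2 * suc k ≤ suc n → 2 * (n C k) ≤ suc n C suc k
2*nCk≤[1+n]C[1+k] n k 2[1+k]≤1+n = *-cancelˡ-≤ (suc n) (begin
  suc n * (2 * (n C k))             ≡⟨ x∙yz≈y∙xz (suc n) 2 (n C k) ⟩
  2 * (suc n * (n C k))             ≡⟨ cong (2 *_) ([1+k]*[1+n]C[1+k]≡[1+n]*nCk n k) ⟨
  2 * (suc k * (suc n C suc k))     ≡⟨ *-assoc 2 (suc k) _ ⟨
  2 * suc k * (suc n C suc k)       ≤⟨ *-monoˡ-≤ (suc n C suc k) 2[1+k]≤1+n ⟩
  suc n * (suc n C suc k)           ∎)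
  where open ≤-Reasoning

2^s*nCk≤[s+n]C[s+k] : ∀ s n k → 2 * (s + k) ≤ s + n → 2 ^ s * (n C k) ≤ (s + n) C (s + k)
2^s*nCk≤[s+n]C[s+k] zero    n k _ = ≤-reflexive (+-identityʳ (n C k))
2^s*nCk≤[s+n]C[s+k] (suc s) n k h = begin
  2 * 2 ^ s * (n C k)       ≡⟨ *-assoc 2 (2 ^ s) (n C k) ⟩
  2 * (2 ^ s * (n C k))     ≤⟨ *-monoʳ-≤ 2 (2^s*nCk≤[s+n]C[s+k] s n k h′) ⟩
  2 * ((s + n) C (s + k))   ≤⟨ 2*nCk≤[1+n]C[1+k] (s + n) (s + k) h ⟩
  (suc s + n) C (suc s + k) ∎
  where
  open ≤-Reasoning
  h′ : 2 * (s + k) ≤ s + n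
  h′ = ≤-trans (+-monoʳ-≤ (s + k) (n≤1+n _)) (≤-pred h)

-- Powers of two and the degree condition

2*n≤2^n : ∀ n → 2 * n ≤ 2 ^ n
2*n≤2^n zero = z≤n
2*n≤2^n (suc zero) = ≤-refl
2*n≤2^n (suc n@(suc _)) = begin
  2 * suc n      ≡⟨ *-suc 2 n ⟩
  2 + 2 * n      ≤⟨ +-mono-≤ (^-monoʳ-≤ 2 {1} {n} (s≤s z≤n)) (2*n≤2^n n) ⟩
  2 ^ n + 2 ^ n  ≡⟨ cong (2 ^ n +_) (+-identityʳ (2 ^ n)) ⟨
  2 ^ suc n      ∎
  where open ≤-Reasoning

2^p*d≤2^d : ∀ p {d} → 2 * p ≤ d → 2 ^ p * d ≤ 2 ^ d
2^p*d≤2^d p 2p≤d = go (≤⇒≤′ 2p≤d)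
  where
  open ≤-Reasoning
  go : ∀ {d} → 2 * p ≤′ d → 2 ^ p * d ≤ 2 ^ d
  go ≤′-refl = begin
    2 ^ p * (2 * p)          ≤⟨ *-monoʳ-≤ (2 ^ p) (2*n≤2^n p) ⟩
    2 ^ p * 2 ^ p            ≡⟨ cong (λ x → 2 ^ p * 2 ^ x) (+-identityʳ p) ⟨
    2 ^ p * 2 ^ (p + 0)      ≡⟨ ^-distribˡ-+-* 2 p (p + 0) ⟨
    2 ^ (2 * p)              ∎
  go {suc d} (≤′-step 2p≤′d) = begin
    2 ^ p * suc d            ≡⟨ *-suc (2 ^ p) d ⟩
    2 ^ p + 2 ^ p * d        ≤⟨ +-mono-≤ (^-monoʳ-≤ 2 p≤d) (go 2p≤′d) ⟩
    2 ^ d + 2 ^ d            ≡⟨ cong (2 ^ d +_) (+-identityʳ (2 ^ d)) ⟨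
    2 ^ suc d                ∎
    where
    p≤d : p ≤ d
    p≤d = ≤-trans (m≤m+n p (p + 0)) (≤′⇒≤ 2p≤′d)

log₂-bracket : ∀ n → 1 ≤ n → ∃[ m ] 2 ^ m ≤ n × n < 2 ^ suc m
log₂-bracket (suc zero)    _ = 0 , ≤-refl , s≤s (s≤s z≤n)
log₂-bracket (suc (suc n)) _ with log₂-bracket (suc n) (s≤s z≤n)
... | m , 2^m≤1+n , 1+n<2^[1+m] with suc (suc n) <? 2 ^ suc m
...   | yes 2+n<2^[1+m] = m , m≤n⇒m≤1+n 2^m≤1+n , 2+n<2^[1+m]
...   | no  2+n≮2^[1+m] =
  suc m , ≤-reflexive (sym 2+n≡2^[1+m]) , ≤-<-trans (≤-reflexive 2+n≡2^[1+m]) (^-monoʳ-< 2 ≤-refl (n<1+n (suc m)))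
  where
  2+n≡2^[1+m] : suc (suc n) ≡ 2 ^ suc m
  2+n≡2^[1+m] = ≤-antisym 1+n<2^[1+m] (≮⇒≥ 2+n≮2^[1+m])

LogDegreeCondition-mono : ∀ {n d e} → d ≤ e → LogDegreeCondition n d → LogDegreeCondition n e
LogDegreeCondition-mono d≤e cond a b 1≤b 2^a<n^b =
  ≤-trans (cond a b 1≤b 2^a<n^b) (*-monoʳ-≤ (b * b) (^-monoʳ-≤ 2 d≤e))

Refutes : ℕ → ℕ → ℕ → ℕ → Set
Refutes n d a b = 2 ^ a < n ^ b × b * b * 2 ^ d < a * a * n

refutes⇒¬LogDegreeCondition : ∀ n d a b → 1 ≤ b → Refutes n d a b → ¬ LogDegreeCondition n d
refutes⇒¬LogDegreeCondition n d a b 1≤b (2^a<n^b , violated) cond =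
  <⇒≱ violated (cond a b 1≤b 2^a<n^b)

PowerBound : ℕ → ℕ → Set
PowerBound n d = 2 * d + 1 ≤ n → 2 * n * d ≤ 2 ^ d

BoundOrRefuted : ℕ → ℕ → Set
BoundOrRefuted n d = PowerBound n d ⊎ Σ[ a ∈ Fin 16 ] Σ[ b ∈ Fin 2 ] Refutes n d (toℕ a) (suc (toℕ b))

-- Below 64 vertices the rational approximations a/b of log₂ n with b ≤ 2 already suffice,
-- and the finitely many cases are decided by evaluation.
boundOrRefuted<64 : ∀ (n : Fin 64) (d : Fin 32) → BoundOrRefuted (toℕ n) (toℕ d)
boundOrRefuted<64 = toWitness {a? = Fin.all? λ n → Fin.all? λ d → boundOrRefuted? (toℕ n) (toℕ d)} _
  where
  boundOrRefuted? : ∀ n d → Dec (BoundOrRefuted n d)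
  boundOrRefuted? n d =
    ((2 * d + 1 ≤? n) →-dec (2 * n * d ≤? 2 ^ d)) ⊎-dec
    Fin.any? λ a → Fin.any? λ b →
      (2 ^ toℕ a <? n ^ suc (toℕ b)) ×-dec (suc (toℕ b) * suc (toℕ b) * 2 ^ d <? toℕ a * toℕ a * n)

powerBound-small : ∀ {n d} → n < 64 → LogDegreeCondition n d → PowerBound n d
powerBound-small {n} {d} n<64 cond 2d+1≤n =
  conclude (subst₂ BoundOrRefuted (toℕ-fromℕ< n<64) (toℕ-fromℕ< d<32) (boundOrRefuted<64 (fromℕ< n<64) (fromℕ< d<32)))
  where
  d<32 : d < 32
  d<32 = *-cancelˡ-< 2 d 32 (<-trans (≤-trans (≤-reflexive (+-comm 1 (2 * d))) 2d+1≤n) n<64)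
  conclude : BoundOrRefuted n d → 2 * n * d ≤ 2 ^ d
  conclude (inj₁ bound)         = bound 2d+1≤n
  conclude (inj₂ (a , b , ref)) = contradiction cond (refutes⇒¬LogDegreeCondition n d (toℕ a) (suc (toℕ b)) (s≤s z≤n) ref)

32*2[3+m]≤[4m+3]² : ∀ {m} → 5 ≤ m → 32 * (2 * (3 + m)) ≤ (m * 4 + 3) * (m * 4 + 3)
32*2[3+m]≤[4m+3]² 5≤m with m≤n⇒∃[o]m+o≡n 5≤m
... | r , refl = ≤-trans (m≤m+n _ (16 * r * r + 120 * r + 17)) (≤-reflexive (sym (expand r)))
  where
  expand : ∀ r → ((5 + r) * 4 + 3) * ((5 + r) * 4 + 3) ≡ 32 * (2 * (8 + r)) + (16 * r * r + 120 * r + 17)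
  expand = solve-∀

-- With 2^(m+1) ≤ n < 2^(m+2), the fraction a/4 = (4m+3)/4 lies below log₂ n, so the condition
-- gives a² n ≤ 16 · 2^d. Either 32 d ≤ a², and then 2 n d ≤ 2^d directly, or d > 2(m+3),
-- and then 2 n d < 2^(m+3) d ≤ 2^d.
powerBound-large : ∀ {n d} → 64 ≤ n → LogDegreeCondition n d → 2 * n * d ≤ 2 ^ d
powerBound-large {n} {d} 64≤n cond with log₂-bracket n (≤-trans (s≤s z≤n) 64≤n)
... | zero  , _ , n<2 = ⊥-elim (<⇒≱ n<2 (≤-trans (s≤s (s≤s z≤n)) 64≤n))
... | suc m , 2^[1+m]≤n , n<2^[2+m] = by-cases (32 * d ≤? a * a)
  where
  open ≤-Reasoning
  a = m * 4 + 3
  1+a≡[1+m]*4 : ∀ m → suc (m * 4 + 3) ≡ suc m * 4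
  1+a≡[1+m]*4 = solve-∀
  16*[2*x*y]≡32*y*x : ∀ x y → 16 * (2 * x * y) ≡ 32 * y * x
  16*[2*x*y]≡32*y*x = solve-∀
  2^a<n⁴ : 2 ^ a < n ^ 4
  2^a<n⁴ = begin-strict
    2 ^ a                <⟨ ^-monoʳ-< 2 ≤-refl (n<1+n a) ⟩
    2 ^ suc a            ≡⟨ cong (2 ^_) (1+a≡[1+m]*4 m) ⟩
    2 ^ (suc m * 4)      ≡⟨ ^-*-assoc 2 (suc m) 4 ⟨
    (2 ^ suc m) ^ 4      ≤⟨ ^-monoˡ-≤ 4 2^[1+m]≤n ⟩
    n ^ 4                ∎
  5≤m : 5 ≤ m
  5≤m = ≮⇒≥ λ m<5 → <⇒≱ (<-≤-trans n<2^[2+m] (^-monoʳ-≤ 2 (s≤s m<5))) 64≤n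
  by-cases : Dec (32 * d ≤ a * a) → 2 * n * d ≤ 2 ^ d
  by-cases (yes 32d≤a²) = *-cancelˡ-≤ 16 (begin
    16 * (2 * n * d)  ≡⟨ 16*[2*x*y]≡32*y*x n d ⟩
    32 * d * n        ≤⟨ *-monoˡ-≤ n 32d≤a² ⟩
    a * a * n         ≤⟨ cond a 4 (s≤s z≤n) 2^a<n⁴ ⟩
    16 * 2 ^ d        ∎)
  by-cases (no 32d≰a²) = begin
    2 * n * d         ≤⟨ *-monoˡ-≤ d (*-monoʳ-≤ 2 (<⇒≤ n<2^[2+m])) ⟩
    2 ^ (3 + m) * d   ≤⟨ 2^p*d≤2^d (3 + m) (<⇒≤ 2[3+m]<d) ⟩
    2 ^ d             ∎
    where
    2[3+m]<d : 2 * (3 + m) < d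
    2[3+m]<d = *-cancelˡ-< 32 _ d (≤-<-trans (32*2[3+m]≤[4m+3]² 5≤m) (≰⇒> 32d≰a²))

powerBound : ∀ {n d} → LogDegreeCondition n d → PowerBound n d
powerBound {n} cond with n <? 64
... | yes n<64 = powerBound-small n<64 cond
... | no  n≮64 = λ _ → powerBound-large (≮⇒≥ n≮64) cond

-- Finite sums and counting

∑-mono-≤ : ∀ {n} {f g : Fin n → ℕ} → (∀ i → f i ≤ g i) → ∑[ i < n ] f i ≤ ∑[ i < n ] g i
∑-mono-≤ {zero}  f≤g = z≤n
∑-mono-≤ {suc n} f≤g = +-mono-≤ (f≤g zero) (∑-mono-≤ (λ i → f≤g (suc i)))

term≤∑ : ∀ {n} (f : Fin n → ℕ) i → f i ≤ ∑[ j < n ] f j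
term≤∑ f zero    = m≤m+n (f zero) _
term≤∑ f (suc i) = ≤-trans (term≤∑ (λ j → f (suc j)) i) (m≤n+m _ (f zero))

∑-const : ∀ n c → ∑[ i < n ] c ≡ n * c
∑-const zero    c = refl
∑-const (suc n) c = cong (c +_) (∑-const n c)

∑-indicator : ∀ {n} (f : Fin n → Bool) c → ∑[ i < n ] (if f i then c else 0) ≡ ∣ tabulate f ∣ * c
∑-indicator {zero}  f c = refl
∑-indicator {suc n} f c with f zero
... | true  = cong (c +_) (∑-indicator (λ i → f (suc i)) c)
... | false = ∑-indicator (λ i → f (suc i)) c

count : ∀ {A : Set} → (A → Bool) → List A → ℕ
count p []       = 0
count p (x ∷ xs) = if p x then suc (count p xs) else count p xs

length-filter≡count : ∀ {A : Set} {P : A → Set} (P? : ∀ x → Dec (P x)) xs →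
                      length (filter P? xs) ≡ count (λ x → does (P? x)) xs
length-filter≡count P? []       = refl
length-filter≡count P? (x ∷ xs) with does (P? x)
... | true  = cong suc (length-filter≡count P? xs)
... | false = length-filter≡count P? xs

count-∷ : ∀ {A : Set} (p : A → Bool) x xs → count p (x ∷ xs) ≡ count p [ x ] + count p xs
count-∷ p x xs with p x
... | true  = refl
... | false = refl

count-++ : ∀ {A : Set} (p : A → Bool) xs ys → count p (xs ++ ys) ≡ count p xs + count p ys
count-++ p []       ys = refl
count-++ p (x ∷ xs) ys with p x
... | true  = cong suc (count-++ p xs ys)
... | false = count-++ p xs ys

count-map : ∀ {A B : Set} (p : B → Bool) (f : A → B) xs → count p (map f xs) ≡ count (λ x → p (f x)) xs
count-map p f []       = refl
count-map p f (x ∷ xs) with p (f x)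
... | true  = cong suc (count-map p f xs)
... | false = count-map p f xs

count-mono : ∀ {A : Set} (p q : A → Bool) {xs} → (∀ {x} → x ∈ₗ xs → T (p x) → T (q x)) → count p xs ≤ count q xs
count-mono p q {[]}     p⇒q = z≤n
count-mono p q {x ∷ xs} p⇒q with p x | q x | p⇒q (here refl)
... | true  | true  | _   = s≤s (count-mono p q (p⇒q ∘′ there))
... | true  | false | imp = ⊥-elim (imp tt)
... | false | true  | _   = m≤n⇒m≤1+n (count-mono p q (p⇒q ∘′ there))
... | false | false | _   = count-mono p q (p⇒q ∘′ there)

count-false : ∀ {A : Set} (xs : List A) → count (λ _ → false) xs ≡ 0
count-false []       = refl
count-false (x ∷ xs) = count-false xs

1≤count-[x] : ∀ {A : Set} (p : A → Bool) x → T (p x) → 1 ≤ count p [ x ]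
1≤count-[x] p x px with p x
... | true = ≤-refl

count-union-bound : ∀ {A : Set} {m} (p : A → Bool) (q : Fin m → A → Bool) xs →
                    (∀ {x} → x ∈ₗ xs → T (p x) → ∃[ i ] T (q i x)) →
                    count p xs ≤ ∑[ i < m ] count (q i) xs
count-union-bound p q []       _     = z≤n
count-union-bound {m = m} p q (x ∷ xs) cover = begin
  count p (x ∷ xs)                                            ≡⟨ count-∷ p x xs ⟩
  count p [ x ] + count p xs                                  ≤⟨ +-mono-≤ head (count-union-bound p q xs (cover ∘′ there)) ⟩
  ∑[ i < m ] count (q i) [ x ] + ∑[ i < m ] count (q i) xs    ≡⟨ ∑-distrib-+ (λ i → count (q i) [ x ]) _ ⟨
  ∑[ i < m ] (count (q i) [ x ] + count (q i) xs)             ≡⟨ sum-cong-≗ (λ i → count-∷ (q i) x xs) ⟨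
  ∑[ i < m ] count (q i) (x ∷ xs)                             ∎
  where
  open ≤-Reasoning
  head : count p [ x ] ≤ ∑[ i < m ] count (q i) [ x ]
  head with p x | cover (here refl)
  ... | false | _     = z≤n
  ... | true  | cover-x with cover-x tt
  ...   | i , qix = ≤-trans (1≤count-[x] (q i) x qix) (term≤∑ (λ j → count (q j) [ x ]) i)

subsetsOfSize : (n k : ℕ) → List (Subset n)
subsetsOfSize zero    zero    = [ [] ]
subsetsOfSize zero    (suc k) = []
subsetsOfSize (suc n) zero    = map (outside ∷_) (subsetsOfSize n zero)
subsetsOfSize (suc n) (suc k) = map (inside ∷_) (subsetsOfSize n k) ++ map (outside ∷_) (subsetsOfSize n (suc k))

∈-subsetsOfSize⁻ : ∀ {n k} {B : Subset n} → B ∈ₗ subsetsOfSize n k → ∣ B ∣ ≡ k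
∈-subsetsOfSize⁻ {zero}  {zero}  {[]} _ = refl
∈-subsetsOfSize⁻ {suc n} {zero}  B∈ with ∈-map⁻ (outside ∷_) B∈
... | _ , C∈ , refl = ∈-subsetsOfSize⁻ C∈
∈-subsetsOfSize⁻ {suc n} {suc k} B∈ with ∈-++⁻ (map (inside ∷_) (subsetsOfSize n k)) B∈
... | inj₁ B∈ˡ with ∈-map⁻ (inside ∷_) B∈ˡ
...   | _ , C∈ , refl = cong suc (∈-subsetsOfSize⁻ C∈)
∈-subsetsOfSize⁻ {suc n} {suc k} B∈ | inj₂ B∈ʳ with ∈-map⁻ (outside ∷_) B∈ʳ
...   | _ , C∈ , refl = ∈-subsetsOfSize⁻ C∈

∈-subsetsOfSize⁺ : ∀ {n k} (B : Subset n) → ∣ B ∣ ≡ k → B ∈ₗ subsetsOfSize n k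
∈-subsetsOfSize⁺ {zero}  {zero}  []            _ = here refl
∈-subsetsOfSize⁺ {suc n} {zero}  (outside ∷ B) ∣B∣≡0 = ∈-map⁺ (outside ∷_) (∈-subsetsOfSize⁺ B ∣B∣≡0)
∈-subsetsOfSize⁺ {suc n} {suc k} (inside ∷ B)  ∣B∣≡k =
  ∈-++⁺ˡ (∈-map⁺ (inside ∷_) (∈-subsetsOfSize⁺ B (suc-injective ∣B∣≡k)))
∈-subsetsOfSize⁺ {suc n} {suc k} (outside ∷ B) ∣B∣≡k =
  ∈-++⁺ʳ (map (inside ∷_) (subsetsOfSize n k)) (∈-map⁺ (outside ∷_) (∈-subsetsOfSize⁺ B ∣B∣≡k))

subsetsOfSize-unique : ∀ n k → Unique (subsetsOfSize n k)
subsetsOfSize-unique zero    zero    = All.[] ∷ []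
subsetsOfSize-unique zero    (suc k) = []
subsetsOfSize-unique (suc n) zero    = Unique.map⁺ ∷-injectiveʳ (subsetsOfSize-unique n zero)
subsetsOfSize-unique (suc n) (suc k) =
  Unique.++⁺ (Unique.map⁺ ∷-injectiveʳ (subsetsOfSize-unique n k))
             (Unique.map⁺ ∷-injectiveʳ (subsetsOfSize-unique n (suc k)))
             disjoint
  where
  disjoint : ∀ {B} → B ∈ₗ map (inside ∷_) (subsetsOfSize n k) × B ∈ₗ map (outside ∷_) (subsetsOfSize n (suc k)) → ⊥
  disjoint (B∈ˡ , B∈ʳ) with ∈-map⁻ (inside ∷_) B∈ˡ | ∈-map⁻ (outside ∷_) B∈ʳ
  ... | _ , _ , refl | _ , _ , ()

-- The number of k-subsets containing a fixed a-subset, m further elements being available.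
supersets : ℕ → ℕ → ℕ → ℕ
supersets m zero    k       = m C k
supersets m (suc a) zero    = 0
supersets m (suc a) (suc k) = supersets m a k

supersets-+ : ∀ m a j → supersets m a (a + j) ≡ m C j
supersets-+ m zero    j = refl
supersets-+ m (suc a) j = supersets-+ m a j

supersets-< : ∀ m {a k} → k < a → supersets m a k ≡ 0
supersets-< m {suc a} {zero}  _         = refl
supersets-< m {suc a} {suc k} (s≤s k<a) = supersets-< m k<a

supersets-0 : ∀ m m′ a → supersets m a 0 ≡ supersets m′ a 0
supersets-0 m m′ zero    = refl
supersets-0 m m′ (suc a) = refl

supersets-pascal : ∀ m a k → supersets m a k + supersets m a (suc k) ≡ supersets (suc m) a (suc k)
supersets-pascal m zero    k       = nCk+nC[k+1]≡[n+1]C[k+1] m k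
supersets-pascal m (suc a) zero    = supersets-0 m (suc m) a
supersets-pascal m (suc a) (suc k) = supersets-pascal m a k

infix 4 _⊆ᵇ_
_⊆ᵇ_ : ∀ {n} → Subset n → Subset n → Bool
A ⊆ᵇ B = does (A ⊆? B)

count-⊇ : ∀ {n} (A : Subset n) k → count (A ⊆ᵇ_) (subsetsOfSize n k) ≡ supersets (n ∸ ∣ A ∣) ∣ A ∣ k
count-⊇ []            zero    = refl
count-⊇ []            (suc k) = refl
count-⊇ {suc n} (inside ∷ A)  zero    =
  trans (count-map (inside ∷ A ⊆ᵇ_) (outside ∷_) (subsetsOfSize n zero)) (count-false (subsetsOfSize n zero))
count-⊇ {suc n} (inside ∷ A) (suc k) = begin
  count p (ins ++ outs)       ≡⟨ count-++ p ins outs ⟩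
  count p ins + count p outs  ≡⟨ cong₂ _+_ (trans (count-map p (inside ∷_) (subsetsOfSize n k)) (count-⊇ A k))
                                            (trans (count-map p (outside ∷_) (subsetsOfSize n (suc k)))
                                                   (count-false (subsetsOfSize n (suc k)))) ⟩
  S + 0                       ≡⟨ +-identityʳ S ⟩
  S                           ∎
  where
  open ≡-Reasoning
  p = inside ∷ A ⊆ᵇ_
  ins outs : List (Subset (suc n))
  ins  = map (inside ∷_) (subsetsOfSize n k)
  outs = map (outside ∷_) (subsetsOfSize n (suc k))
  S = supersets (n ∸ ∣ A ∣) ∣ A ∣ k
count-⊇ {suc n} (outside ∷ A) zero    =
  trans (trans (count-map (outside ∷ A ⊆ᵇ_) (outside ∷_) (subsetsOfSize n zero)) (count-⊇ A zero))
        (supersets-0 _ _ ∣ A ∣)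
count-⊇ {suc n} (outside ∷ A) (suc k) = begin
  count p (ins ++ outs)                       ≡⟨ count-++ p ins outs ⟩
  count p ins + count p outs                  ≡⟨ cong₂ _+_ (trans (count-map p (inside ∷_) (subsetsOfSize n k)) (count-⊇ A k))
                                                            (trans (count-map p (outside ∷_) (subsetsOfSize n (suc k)))
                                                                   (count-⊇ A (suc k))) ⟩
  supersets m a k + supersets m a (suc k)     ≡⟨ supersets-pascal m a k ⟩
  supersets (suc m) a (suc k)                 ≡⟨ cong (λ m → supersets m a (suc k)) (+-∸-assoc 1 (∣p∣≤n A)) ⟨
  supersets (suc n ∸ a) a (suc k)             ∎
  where
  open ≡-Reasoning
  p = outside ∷ A ⊆ᵇ_
  ins outs : List (Subset (suc n))
  ins  = map (inside ∷_) (subsetsOfSize n k)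
  outs = map (outside ∷_) (subsetsOfSize n (suc k))
  a = ∣ A ∣
  m = n ∸ a

n*e*supersetsₑ≤supersets₁ : ∀ m k e → 2 * k + 1 ≤ suc m → (e ≤ k → 2 * suc m * e ≤ 2 ^ e) →
               suc m * (e * supersets (suc m ∸ e) e k) ≤ supersets m 1 k
n*e*supersetsₑ≤supersets₁ m k zero _ _ = ≤-trans (≤-reflexive (*-zeroʳ (suc m))) z≤n
n*e*supersetsₑ≤supersets₁ m k (suc s) 2k+1≤n power with suc s ≤? k
... | no  k≱e = ≤-trans (≤-reflexive vanishes) z≤n
  where
  vanishes : suc m * (suc s * supersets (m ∸ s) (suc s) k) ≡ 0
  vanishes = trans (cong (λ x → suc m * (suc s * x)) (supersets-< (m ∸ s) (≰⇒> k≱e)))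
                   (trans (cong (suc m *_) (*-zeroʳ (suc s))) (*-zeroʳ (suc m)))
... | yes e≤k with m≤n⇒∃[o]m+o≡n e≤k
... | j , refl with m≤n⇒∃[o]m+o≡n (≤-trans (n≤1+n s) (≤-trans e≤k k≤m))
  where
  k≤m : suc s + j ≤ m
  k≤m = ≤-trans (m≤m+n (suc s + j) (suc s + j + 0)) (≤-pred (subst (_≤ suc m) (+-comm (2 * (suc s + j)) 1) 2k+1≤n))
... | N , refl = begin
  n * (suc s * supersets (s + N ∸ s) (suc s) (suc s + j))  ≡⟨ cong (λ x → n * (suc s * x)) supersets≡NCj ⟩
  n * (suc s * (N C j))                                     ≡⟨ *-assoc n (suc s) (N C j) ⟨
  n * suc s * (N C j)                                       ≤⟨ *-monoˡ-≤ (N C j) n*e≤2^s ⟩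
  2 ^ s * (N C j)                                           ≤⟨ 2^s*nCk≤[s+n]C[s+k] s N j 2[s+j]≤s+N ⟩
  (s + N) C (s + j)                                         ∎
  where
  open ≤-Reasoning
  n = suc (s + N)
  supersets≡NCj : supersets (s + N ∸ s) (suc s) (suc s + j) ≡ N C j
  supersets≡NCj = trans (cong (λ x → supersets x (suc s) (suc s + j)) (m+n∸m≡n s N)) (supersets-+ N (suc s) j)
  n*e≤2^s : n * suc s ≤ 2 ^ s
  n*e≤2^s = *-cancelˡ-≤ 2 (≤-trans (≤-reflexive (sym (*-assoc 2 n (suc s)))) (power e≤k))
  3+2[s+j]≡2k+1 : ∀ s j → 3 + 2 * (s + j) ≡ 2 * (suc s + j) + 1
  3+2[s+j]≡2k+1 = solve-∀
  2[s+j]≤s+N : 2 * (s + j) ≤ s + N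
  2[s+j]≤s+N = ≤-trans (m≤n+m _ 2) (≤-pred (subst (_≤ n) (sym (3+2[s+j]≡2k+1 s j)) 2k+1≤n))

-- Zero forcing

∈-tabulate⁻ : ∀ {n} {f : Fin n → Bool} {x} → x ∈ tabulate f → f x ≡ true
∈-tabulate⁻ {f = f} {x} x∈ = trans (sym (lookup∘tabulate f x)) ([]=⇒lookup x∈)

∈-tabulate⁺ : ∀ {n} {f : Fin n → Bool} {x} → f x ≡ true → x ∈ tabulate f
∈-tabulate⁺ {f = f} {x} fx = lookup⇒[]= x _ (trans (lookup∘tabulate f x) fx)

∣p∪⁅x⁆∣≡1+∣p∣ : ∀ {n} (p : Subset n) {x} → x ∉ p → ∣ p ∪ ⁅ x ⁆ ∣ ≡ suc ∣ p ∣
∣p∪⁅x⁆∣≡1+∣p∣ (inside  ∷ p) {zero}  x∉p = contradiction here x∉p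
∣p∪⁅x⁆∣≡1+∣p∣ (outside ∷ p) {zero}  x∉p = cong (suc ∘ ∣_∣) (∪-identityʳ p)
∣p∪⁅x⁆∣≡1+∣p∣ (inside  ∷ p) {suc x} x∉p = cong suc (∣p∪⁅x⁆∣≡1+∣p∣ p (x∉p ∘ there))
∣p∪⁅x⁆∣≡1+∣p∣ (outside ∷ p) {suc x} x∉p = ∣p∪⁅x⁆∣≡1+∣p∣ p (x∉p ∘ there)

∣p∣≡1+∣p-x∣ : ∀ {n} (p : Subset n) {x} → x ∈ p → ∣ p ∣ ≡ suc ∣ p - x ∣
∣p∣≡1+∣p-x∣ (inside  ∷ p) {zero}  here       = cong (suc ∘ ∣_∣) (sym (p─⊥≡p p))
∣p∣≡1+∣p-x∣ (inside  ∷ p) {suc x} (there x∈) = cong suc (∣p∣≡1+∣p-x∣ p x∈)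
∣p∣≡1+∣p-x∣ (outside ∷ p) {suc x} (there x∈) = ∣p∣≡1+∣p-x∣ p x∈

x∈p-y⇒x≢y : ∀ {n} (p : Subset n) {x y} → x ∈ p - y → x ≢ y
x∈p-y⇒x≢y (s ∷ p) {zero}  {zero}  ()
x∈p-y⇒x≢y (s ∷ p) {suc x} {zero}  _          ()
x∈p-y⇒x≢y (s ∷ p) {zero}  {suc y} _          ()
x∈p-y⇒x≢y (s ∷ p) {suc x} {suc y} (there x∈) = x∈p-y⇒x≢y p x∈ ∘ Fin.suc-injective

OthersBlue : ∀ {n} → Graph n → Subset n → Fin n → Fin n → Set
OthersBlue G B u v = ∀ w → Adj G u w → w ≢ v → w ∈ B

CanForce : ∀ {n} → Graph n → Subset n → Fin n → Fin n → Set
CanForce G B u v = u ∈ B × v ∉ B × Adj G u v × OthersBlue G B u v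

canForce? : ∀ {n} (G : Graph n) B u v → Dec (CanForce G B u v)
canForce? G B u v =
  u ∈? B ×-dec ¬? (v ∈? B) ×-dec G u v Bool.≟ true ×-dec
  Fin.all? (λ w → G u w Bool.≟ true →-dec ¬? (w Fin.≟ v) →-dec w ∈? B)

zeroForcing? : ∀ {n} (G : Graph n) B → Dec (ZeroForcing G B)
zeroForcing? {n} G B = go n B (m≤m+n n ∣ B ∣)
  where
  go : ∀ fuel B → n ≤ fuel + ∣ B ∣ → Dec (ZeroForcing G B)
  go zero       B n≤∣B∣ = yes (done λ v → subst (v ∈_) (sym B≡⊤) ∈⊤)
    where
    B≡⊤ : B ≡ ⊤
    B≡⊤ = ∣p∣≡n⇒p≡⊤ (≤-antisym (∣p∣≤n B) n≤∣B∣)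
  go (suc fuel) B bound with Fin.all? (_∈? B)
  ... | yes all∈ = yes (done all∈)
  ... | no  ¬all∈ = map′ (λ (u , v , (u∈ , v∉ , uv , others) , zf) → force u v u∈ v∉ uv others zf)
                         (λ { (done all∈) → contradiction all∈ ¬all∈
                            ; (force u v u∈ v∉ uv others zf) → u , v , (u∈ , v∉ , uv , others) , zf })
                         (Fin.any? λ u → Fin.any? λ v → step? u v)
    where
    step? : ∀ u v → Dec (CanForce G B u v × ZeroForcing G (B ∪ ⁅ v ⁆))
    step? u v with canForce? G B u v
    ... | no ¬can = no (¬can ∘ proj₁)
    ... | yes can@(_ , v∉ , _) = map′ (can ,_) proj₂ (go fuel (B ∪ ⁅ v ⁆) bound′)
      where
      bound′ : n ≤ fuel + ∣ B ∪ ⁅ v ⁆ ∣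
      bound′ = ≤-trans bound (≤-reflexive (trans (sym (+-suc fuel ∣ B ∣))
                                                 (cong (fuel +_) (sym (∣p∪⁅x⁆∣≡1+∣p∣ B v∉)))))

zeroForcing-mono : ∀ {n} {G : Graph n} {B B′} → B ⊆ B′ → ZeroForcing G B → ZeroForcing G B′
zeroForcing-mono B⊆B′ (done all∈) = done (B⊆B′ ∘ all∈)
zeroForcing-mono {B = B} {B′} B⊆B′ (force u v u∈ v∉ uv others zf) with v ∈? B′
... | yes v∈B′ = zeroForcing-mono B∪v⊆B′ zf
  where
  B∪v⊆B′ : B ∪ ⁅ v ⁆ ⊆ B′
  B∪v⊆B′ x∈ = [ B⊆B′ , (λ x∈⁅v⁆ → subst (_∈ B′) (sym (x∈⁅y⁆⇒x≡y v x∈⁅v⁆)) v∈B′) ]′ (x∈p∪q⁻ B ⁅ v ⁆ x∈)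
... | no  v∉B′ = force u v (B⊆B′ u∈) v∉B′ uv (λ w uw w≢v → B⊆B′ (others w uw w≢v)) (zeroForcing-mono B∪v⊆B′∪v zf)
  where
  B∪v⊆B′∪v : B ∪ ⁅ v ⁆ ⊆ B′ ∪ ⁅ v ⁆
  B∪v⊆B′∪v x∈ = x∈p∪q⁺ ([ inj₁ ∘ B⊆B′ , inj₂ ]′ (x∈p∪q⁻ B ⁅ v ⁆ x∈))

forcingSet : ∀ {n} → Graph n → Fin n → Fin n → Subset n
forcingSet G u v = (nbhd G u - v) ∪ ⁅ u ⁆

∣forcingSet∣≡degree : ∀ {n} {G : Graph n} → IsSimple G → ∀ {u v} → Adj G u v → ∣ forcingSet G u v ∣ ≡ degree G u
∣forcingSet∣≡degree {G = G} simple {u} {v} uv =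
  trans (∣p∪⁅x⁆∣≡1+∣p∣ (nbhd G u - v) u∉) (sym (∣p∣≡1+∣p-x∣ (nbhd G u) (∈-tabulate⁺ uv)))
  where
  u∉ : u ∉ nbhd G u - v
  u∉ u∈ with trans (sym (∈-tabulate⁻ (p─q⊆p (nbhd G u) ⁅ v ⁆ u∈))) (IsSimple.irreflexive simple u)
  ... | ()

forcingSet⊆ : ∀ {n} {G : Graph n} {B u v} → u ∈ B → OthersBlue G B u v → forcingSet G u v ⊆ B
forcingSet⊆ {G = G} {B} {u} {v} u∈ others {x} x∈ with x∈p∪q⁻ (nbhd G u - v) ⁅ u ⁆ x∈
... | inj₁ x∈N-v = others x (∈-tabulate⁻ (p─q⊆p (nbhd G u) ⁅ v ⁆ x∈N-v)) (x∈p-y⇒x≢y (nbhd G u) x∈N-v)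
... | inj₂ x∈⁅u⁆ = subst (_∈ B) (sym (x∈⁅y⁆⇒x≡y u x∈⁅u⁆)) u∈

zeroForcing⇒forcingSet⊆ : ∀ {n} {G : Graph n} {B} → ZeroForcing G B → ∣ B ∣ < n →
                         ∃[ u ] ∃[ v ] Adj G u v × forcingSet G u v ⊆ B
zeroForcing⇒forcingSet⊆ {n} {B = B} (done all∈) ∣B∣<n =
  contradiction (≤-trans (≤-reflexive (sym (∣⊤∣≡n n))) (p⊆q⇒∣p∣≤∣q∣ {p = ⊤} {B} (λ {x} _ → all∈ x)))
                (<⇒≱ ∣B∣<n)
zeroForcing⇒forcingSet⊆ {G = G} (force u v u∈ _ uv others _) _ = u , v , uv , forcingSet⊆ {G = G} u∈ others

-- Zero forcing on the path

path-adj⁻ : ∀ {n} {x y : Fin n} → Adj (path n) x y → suc (toℕ x) ≡ toℕ y ⊎ suc (toℕ y) ≡ toℕ x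
path-adj⁻ xy = Sum.map (≡ᵇ⇒≡ _ _) (≡ᵇ⇒≡ _ _) (to T-∨ (from T-≡ xy))

path-adj⁺ : ∀ {n} {x y : Fin n} → suc (toℕ x) ≡ toℕ y ⊎ suc (toℕ y) ≡ toℕ x → Adj (path n) x y
path-adj⁺ {x = x} {y} = to T-≡ ∘ from T-∨ ∘ Sum.map (≡⇒≡ᵇ _ _) (≡⇒≡ᵇ _ _)

interval : ∀ {n} → ℕ → ℕ → Subset n
interval i j = tabulate λ w → (i ≤ᵇ toℕ w) ∧ (toℕ w ≤ᵇ j)

∈-interval⁻ : ∀ {n} i j {x : Fin n} → x ∈ interval i j → i ≤ toℕ x × toℕ x ≤ j
∈-interval⁻ i j x∈ = Product.map (≤ᵇ⇒≤ _ _) (≤ᵇ⇒≤ _ _) (to T-∧ (from T-≡ (∈-tabulate⁻ x∈)))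

∈-interval⁺ : ∀ {n} i j {x : Fin n} → i ≤ toℕ x → toℕ x ≤ j → x ∈ interval i j
∈-interval⁺ i j i≤x x≤j = ∈-tabulate⁺ (to T-≡ (from T-∧ (≤⇒≤ᵇ i≤x , ≤⇒≤ᵇ x≤j)))

[i,j]⊆[1+i,j]∪⁅v⁆ : ∀ {n} i j (v : Fin n) → toℕ v ≡ i → interval i j ⊆ interval (suc i) j ∪ ⁅ v ⁆
[i,j]⊆[1+i,j]∪⁅v⁆ i j v refl {x} x∈ with ∈-interval⁻ i j x∈
... | v≤x , x≤j with m≤n⇒m<n∨m≡n v≤x
...   | inj₁ v<x = x∈p∪q⁺ (inj₁ (∈-interval⁺ (suc i) j v<x x≤j))
...   | inj₂ v≡x = x∈p∪q⁺ (inj₂ (subst (_∈ ⁅ v ⁆) (toℕ-injective v≡x) (x∈⁅x⁆ v)))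

[i,1+j]⊆[i,j]∪⁅v⁆ : ∀ {n} i j (v : Fin n) → toℕ v ≡ suc j → interval i (suc j) ⊆ interval i j ∪ ⁅ v ⁆
[i,1+j]⊆[i,j]∪⁅v⁆ i j v v≡1+j {x} x∈ with ∈-interval⁻ i (suc j) x∈
... | i≤x , x≤1+j with m≤n⇒m<n∨m≡n x≤1+j
...   | inj₁ x<1+j = x∈p∪q⁺ (inj₁ (∈-interval⁺ i j i≤x (≤-pred x<1+j)))
...   | inj₂ x≡1+j = x∈p∪q⁺ (inj₂ (subst (_∈ ⁅ v ⁆) (toℕ-injective (trans v≡1+j (sym x≡1+j))) (x∈⁅x⁆ v)))

suffix-zeroForcing : ∀ {m} i → i ≤ m → ZeroForcing (path (suc m)) (interval i m)
suffix-zeroForcing {m} zero    _     = done λ x → ∈-interval⁺ 0 m z≤n (≤-pred (toℕ<n x))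
suffix-zeroForcing {m} (suc i) 1+i≤m =
  force u v u∈ v∉ uv others (zeroForcing-mono ([i,j]⊆[1+i,j]∪⁅v⁆ i m v toℕv) (suffix-zeroForcing i i≤m))
  where
  i≤m = ≤-trans (n≤1+n i) 1+i≤m
  u v : Fin (suc m)
  u = fromℕ< (s≤s 1+i≤m)
  v = fromℕ< (s≤s i≤m)
  toℕu : toℕ u ≡ suc i
  toℕu = toℕ-fromℕ< (s≤s 1+i≤m)
  toℕv : toℕ v ≡ i
  toℕv = toℕ-fromℕ< (s≤s i≤m)
  u∈ : u ∈ interval (suc i) m
  u∈ = ∈-interval⁺ (suc i) m (≤-reflexive (sym toℕu)) (subst (_≤ m) (sym toℕu) 1+i≤m)
  v∉ : v ∉ interval (suc i) m
  v∉ v∈ = <-irrefl (sym toℕv) (proj₁ (∈-interval⁻ (suc i) m v∈))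
  uv : Adj (path (suc m)) u v
  uv = path-adj⁺ (inj₂ (trans (cong suc toℕv) (sym toℕu)))
  others : OthersBlue (path (suc m)) (interval (suc i) m) u v
  others w uw w≢v with path-adj⁻ uw
  ... | inj₁ 1+u≡w = ∈-interval⁺ (suc i) m (≤-trans (n≤1+n _) (≤-reflexive (trans (cong suc (sym toℕu)) 1+u≡w)))
                                           (≤-pred (toℕ<n w))
  ... | inj₂ 1+w≡u = contradiction (toℕ-injective (trans (suc-injective (trans 1+w≡u toℕu)) (sym toℕv))) w≢v

-- The blue interval grows to the right (j forces 1+j, its left neighbour being blue when j > 0)
-- until it reaches m, and then to the left.
interval-zeroForcing : ∀ {m} r {i j} → j + r ≡ m → i ≤ j → (0 < j → i < j) → ZeroForcing (path (suc m)) (interval i j)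
interval-zeroForcing {m} zero {i} {j} j+0≡m i≤j _ =
  subst (ZeroForcing (path (suc m)) ∘ interval i) (sym j≡m) (suffix-zeroForcing i (subst (i ≤_) j≡m i≤j))
  where
  j≡m : j ≡ m
  j≡m = trans (sym (+-identityʳ j)) j+0≡m
interval-zeroForcing {m} (suc r) {i} {j} j+1+r≡m i≤j i<j =
  force u v u∈ v∉ uv others
    (zeroForcing-mono ([i,1+j]⊆[i,j]∪⁅v⁆ i j v toℕv)
                      (interval-zeroForcing r (trans (sym (+-suc j r)) j+1+r≡m) (≤-trans i≤j (n≤1+n j)) λ _ → s≤s i≤j))
  where
  1+j≤m : suc j ≤ m
  1+j≤m = subst (suc j ≤_) j+1+r≡m (subst (_≤ j + suc r) (+-comm j 1) (+-monoʳ-≤ j (s≤s z≤n)))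
  u v : Fin (suc m)
  u = fromℕ< (s≤s (≤-trans (n≤1+n j) 1+j≤m))
  v = fromℕ< (s≤s 1+j≤m)
  toℕu : toℕ u ≡ j
  toℕu = toℕ-fromℕ< (s≤s (≤-trans (n≤1+n j) 1+j≤m))
  toℕv : toℕ v ≡ suc j
  toℕv = toℕ-fromℕ< (s≤s 1+j≤m)
  u∈ : u ∈ interval i j
  u∈ = ∈-interval⁺ i j (subst (i ≤_) (sym toℕu) i≤j) (≤-reflexive toℕu)
  v∉ : v ∉ interval i j
  v∉ v∈ = <-irrefl refl (subst (_≤ j) toℕv (proj₂ (∈-interval⁻ i j v∈)))
  uv : Adj (path (suc m)) u v
  uv = path-adj⁺ (inj₁ (trans (cong suc toℕu) (sym toℕv)))
  others : OthersBlue (path (suc m)) (interval i j) u v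
  others w uw w≢v with path-adj⁻ uw
  ... | inj₁ 1+u≡w = contradiction (toℕ-injective (trans (sym 1+u≡w) (trans (cong suc toℕu) (sym toℕv)))) w≢v
  ... | inj₂ 1+w≡u = ∈-interval⁺ i j (≤-pred (subst (i <_) (sym 1+w≡j) (i<j (subst (0 <_) 1+w≡j (s≤s z≤n)))))
                                     (≤-trans (n≤1+n _) (≤-reflexive 1+w≡j))
    where
    1+w≡j : suc (toℕ w) ≡ j
    1+w≡j = trans 1+w≡u toℕu

data Seed {n : ℕ} (B : Subset n) : Set where
  last : ∀ {x} → suc (toℕ x) ≡ n → x ∈ B → Seed B
  pair : ∀ {x y} → suc (toℕ x) ≡ toℕ y → x ∈ B → y ∈ B → Seed B

seed-∷ : ∀ {n} {B : Subset n} b → Seed B → Seed (b ∷ B)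
seed-∷ b (last x-last x∈) = last (cong suc x-last) (there x∈)
seed-∷ b (pair x-y x∈ y∈) = pair (cong suc x-y) (there x∈) (there y∈)

seed-or-sparse : ∀ {n} (B : Subset n) → Seed B ⊎ 2 * ∣ B ∣ ≤ n
seed-or-sparse []                    = inj₂ z≤n
seed-or-sparse (outside ∷ B)         = Sum.map (seed-∷ outside) m≤n⇒m≤1+n (seed-or-sparse B)
seed-or-sparse (inside ∷ [])         = inj₁ (last {x = zero} refl here)
seed-or-sparse (inside ∷ inside ∷ B) = inj₁ (pair {x = zero} {suc zero} refl here (there here))
seed-or-sparse {suc (suc n)} (inside ∷ outside ∷ B) =
  Sum.map (seed-∷ inside ∘ seed-∷ outside) (λ 2∣B∣≤n → s≤s (subst (_≤ suc n) (sym (+-suc ∣ B ∣ (∣ B ∣ + 0))) (s≤s 2∣B∣≤n)))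
          (seed-or-sparse B)

half⇒seed : ∀ {m} (B : Subset (suc m)) → suc m ≤ 2 * ∣ B ∣ → zero ∈ B ⊎ Seed B
half⇒seed (inside  ∷ B) _ = inj₁ here
half⇒seed (outside ∷ B) m<2∣B∣ with seed-or-sparse B
... | inj₁ seed   = inj₂ (seed-∷ outside seed)
... | inj₂ 2∣B∣≤m = contradiction m<2∣B∣ (<⇒≱ (s≤s 2∣B∣≤m))

interval⊆ : ∀ {n} {B : Subset n} i j → (∀ {x} → i ≤ toℕ x → toℕ x ≤ j → x ∈ B) → interval i j ⊆ B
interval⊆ i j within x∈ = Product.uncurry within (∈-interval⁻ i j x∈)

first⇒zeroForcing : ∀ {m} {B : Subset (suc m)} → zero ∈ B → ZeroForcing (path (suc m)) B
first⇒zeroForcing {m} {B} 0∈B = zeroForcing-mono (interval⊆ 0 0 only-zero) (interval-zeroForcing m refl z≤n λ ())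
  where
  only-zero : ∀ {x : Fin (suc m)} → 0 ≤ toℕ x → toℕ x ≤ 0 → x ∈ B
  only-zero {zero} _ _ = 0∈B

seed⇒zeroForcing : ∀ {m} {B : Subset (suc m)} → Seed B → ZeroForcing (path (suc m)) B
seed⇒zeroForcing {m} {B} (last {x} x-last x∈) = zeroForcing-mono (interval⊆ m m only-x) (suffix-zeroForcing m ≤-refl)
  where
  only-x : ∀ {z : Fin (suc m)} → m ≤ toℕ z → toℕ z ≤ m → z ∈ B
  only-x m≤z z≤m = subst (_∈ B) (toℕ-injective (trans (suc-injective x-last) (≤-antisym m≤z z≤m))) x∈
seed⇒zeroForcing {m} {B} (pair {x} {y} x-y x∈ y∈) with m≤n⇒∃[o]m+o≡n (≤-pred (subst (_< suc m) (sym x-y) (toℕ<n y)))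
... | r , x+1+r≡m =
  zeroForcing-mono (interval⊆ (toℕ x) (suc (toℕ x)) x-or-y) (interval-zeroForcing r x+1+r≡m (n≤1+n _) λ _ → ≤-refl)
  where
  x-or-y : ∀ {z : Fin (suc m)} → toℕ x ≤ toℕ z → toℕ z ≤ suc (toℕ x) → z ∈ B
  x-or-y {z} x≤z z≤1+x with m≤n⇒m<n∨m≡n x≤z
  ... | inj₂ x≡z = subst (_∈ B) (toℕ-injective x≡z) x∈
  ... | inj₁ x<z = subst (_∈ B) (toℕ-injective (trans (sym x-y) (≤-antisym x<z z≤1+x))) y∈

half⇒zeroForcing : ∀ {m} (B : Subset (suc m)) → suc m ≤ 2 * ∣ B ∣ → ZeroForcing (path (suc m)) B
half⇒zeroForcing B half = Sum.[ first⇒zeroForcing , seed⇒zeroForcing ] (half⇒seed B half)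

-- Comparison of z(G;k) with z(P_n;k)

T-does⁺ : ∀ {A : Set} (a? : Dec A) → A → T (does a?)
T-does⁺ (yes _) _ = tt
T-does⁺ (no ¬a) a = ¬a a

T-does⁻ : ∀ {A : Set} (a? : Dec A) → T (does a?) → A
T-does⁻ (yes a) _ = a

minDegree≤degree : ∀ {n} (G : Graph n) u → minDegree G ≤ degree G u
minDegree≤degree {suc n} G u = go (allFin (suc n)) (∈-allFin u)
  where
  go : ∀ vs → u ∈ₗ vs → foldr (λ v acc → degree G v ⊓ acc) (degree G zero) vs ≤ degree G u
  go (v ∷ vs) (here refl) = m⊓n≤m _ _
  go (v ∷ vs) (there u∈)  = ≤-trans (m⊓n≤n _ _) (go vs u∈)

zfCount : ∀ {n} → Graph n → ℕ → ℕ
zfCount {n} G k = count (λ B → does (zeroForcing? G B)) (subsetsOfSize n k)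

firstForce : ∀ {n} → Graph n → Fin n → Fin n → Subset n → Bool
firstForce G u v B = G u v ∧ (forcingSet G u v ⊆ᵇ B)

zfCount≤∑∑firstForce : ∀ {n} (G : Graph n) k → k < n →
                        zfCount G k ≤ ∑[ u < n ] ∑[ v < n ] count (firstForce G u v) (subsetsOfSize n k)
zfCount≤∑∑firstForce {n} G k k<n =
  ≤-trans (count-union-bound _ someForce xs cover)
          (∑-mono-≤ λ u → count-union-bound (someForce u) (firstForce G u) xs (λ {B} _ → T-does⁻ (someForce? u B)))
  where
  xs = subsetsOfSize n k
  someForce? : ∀ u B → Dec (∃[ v ] T (firstForce G u v B))
  someForce? u B = Fin.any? λ v → T? (firstForce G u v B)
  someForce : Fin n → Subset n → Bool
  someForce u B = does (someForce? u B)
  cover : ∀ {B} → B ∈ₗ xs → T (does (zeroForcing? G B)) → ∃[ u ] T (someForce u B)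
  cover {B} B∈ zf
    with zeroForcing⇒forcingSet⊆ (T-does⁻ (zeroForcing? G B) zf) (subst (_< n) (sym (∈-subsetsOfSize⁻ B∈)) k<n)
  ... | u , v , uv , F⊆B =
    u , T-does⁺ (someForce? u B) (v , from T-∧ (from T-≡ uv , T-does⁺ (forcingSet G u v ⊆? B) F⊆B))

∑firstForce≤degree*supersets : ∀ {n} {G : Graph n} → IsSimple G → ∀ k u →
  ∑[ v < n ] count (firstForce G u v) (subsetsOfSize n k) ≤ degree G u * supersets (n ∸ degree G u) (degree G u) k
∑firstForce≤degree*supersets {n} {G} simple k u = ≤-trans (∑-mono-≤ per-neighbour) (≤-reflexive (∑-indicator (G u) S))
  where
  xs = subsetsOfSize n k
  S = supersets (n ∸ degree G u) (degree G u) k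
  per-neighbour : ∀ v → count (λ B → G u v ∧ (forcingSet G u v ⊆ᵇ B)) xs ≤ (if G u v then S else 0)
  per-neighbour v with G u v in uv
  ... | true  = ≤-reflexive (trans (count-⊇ (forcingSet G u v) k)
                                   (cong (λ a → supersets (n ∸ a) a k) (∣forcingSet∣≡degree simple uv)))
  ... | false = ≤-reflexive (count-false xs)

zfCount-path-large : ∀ {m} (G : Graph (suc m)) k → suc m ≤ 2 * k → zfCount G k ≤ zfCount (path (suc m)) k
zfCount-path-large {m} G k n≤2k =
  count-mono _ (λ B → does (zeroForcing? (path (suc m)) B)) {subsetsOfSize (suc m) k} λ {B} B∈ _ →
    T-does⁺ (zeroForcing? (path (suc m)) B)
            (half⇒zeroForcing B (subst (λ c → suc m ≤ 2 * c) (sym (∈-subsetsOfSize⁻ {k = k} B∈)) n≤2k))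

supersets≤zfCount-path : ∀ m k → supersets m 1 k ≤ zfCount (path (suc m)) k
supersets≤zfCount-path m k = begin
  supersets m 1 k                                   ≡⟨ cong (λ a → supersets (suc m ∸ a) a k) (∣⁅x⁆∣≡1 first) ⟨
  supersets (suc m ∸ ∣ ⁅ first ⁆ ∣) ∣ ⁅ first ⁆ ∣ k  ≡⟨ count-⊇ ⁅ first ⁆ k ⟨
  count (⁅ first ⁆ ⊆ᵇ_) (subsetsOfSize (suc m) k)    ≤⟨ count-mono (⁅ first ⁆ ⊆ᵇ_) _ first∈⇒zeroForcing ⟩
  zfCount (path (suc m)) k                          ∎
  where
  open ≤-Reasoning
  first : Fin (suc m)
  first = zero
  first∈⇒zeroForcing : ∀ {B} → B ∈ₗ subsetsOfSize (suc m) k → T (⁅ first ⁆ ⊆ᵇ B) →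
                       T (does (zeroForcing? (path (suc m)) B))
  first∈⇒zeroForcing {B} _ first⊆B =
    T-does⁺ (zeroForcing? (path (suc m)) B) (first⇒zeroForcing (T-does⁻ (⁅ first ⁆ ⊆? B) first⊆B (x∈⁅x⁆ first)))

zfCount-path-small : ∀ {m} {G : Graph (suc m)} → IsSimple G → LogDegreeCondition (suc m) (minDegree G) →
                     ∀ k → 2 * k + 1 ≤ suc m → zfCount G k ≤ zfCount (path (suc m)) k
zfCount-path-small {m} {G} simple cond k 2k+1≤n = *-cancelˡ-≤ n (begin
  n * zfCount G k               ≤⟨ *-monoʳ-≤ n (zfCount≤∑∑firstForce G k k<n) ⟩
  n * (∑[ u < n ] forces u)     ≡⟨ *-distribˡ-sum n forces ⟩
  ∑[ u < n ] (n * forces u)     ≤⟨ ∑-mono-≤ per-vertex ⟩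
  ∑[ u < n ] supersets m 1 k    ≡⟨ ∑-const n (supersets m 1 k) ⟩
  n * supersets m 1 k           ≤⟨ *-monoʳ-≤ n (supersets≤zfCount-path m k) ⟩
  n * zfCount (path n) k        ∎)
  where
  open ≤-Reasoning
  n = suc m
  k<n : k < n
  k<n = ≤-trans (s≤s (m≤m+n k (k + 0))) (≤-trans (≤-reflexive (+-comm 1 (2 * k))) 2k+1≤n)
  forces : Fin n → ℕ
  forces u = ∑[ v < n ] count (firstForce G u v) (subsetsOfSize n k)
  per-vertex : ∀ u → n * forces u ≤ supersets m 1 k
  per-vertex u = ≤-trans (*-monoʳ-≤ n (∑firstForce≤degree*supersets simple k u))
                         (n*e*supersetsₑ≤supersets₁ m k e 2k+1≤n power)
    where
    e = degree G u
    power : e ≤ k → 2 * n * e ≤ 2 ^ e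
    power e≤k = powerBound (LogDegreeCondition-mono (minDegree≤degree G u) cond)
                           (≤-trans (+-monoˡ-≤ 1 (*-monoʳ-≤ 2 e≤k)) 2k+1≤n)

zfCount≤zfCount-path : ∀ {m} {G : Graph (suc m)} → IsSimple G → LogDegreeCondition (suc m) (minDegree G) →
                       ∀ k → zfCount G k ≤ zfCount (path (suc m)) k
zfCount≤zfCount-path {m} {G} simple cond k with 2 * k + 1 ≤? suc m
... | yes 2k+1≤n = zfCount-path-small simple cond k 2k+1≤n
... | no  2k+1≰n = zfCount-path-large G k (≤-pred (subst (suc (suc m) ≤_) (+-comm (2 * k) 1) (≰⇒> 2k+1≰n)))

filter-enumerates : ∀ {n} (G : Graph n) k → Enumerates-ZF G k (filter (zeroForcing? G) (subsetsOfSize n k))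
filter-enumerates {n} G k = Unique.filter⁺ (zeroForcing? G) (subsetsOfSize-unique n k) , λ B → mk⇔
  (λ B∈ → let B∈xs , zf = ∈-filter⁻ (zeroForcing? G) B∈ in zf , ∈-subsetsOfSize⁻ B∈xs)
  (λ (zf , ∣B∣≡k) → ∈-filter⁺ (zeroForcing? G) (∈-subsetsOfSize⁺ B ∣B∣≡k) zf)

corollary1p7 : (n : ℕ) (G : Graph n) → IsSimple G → 2 ≤ n →
    LogDegreeCondition n (minDegree G) →
    (k : ℕ) →
    ∃[ L₁ ] ∃[ L₂ ] (Enumerates-ZF G k L₁ × Enumerates-ZF (path n) k L₂ × length L₁ ≤ length L₂)
corollary1p7 zero    _ _ () _ _
corollary1p7 (suc m) G simple _ cond k =
  filter (zeroForcing? G) xs , filter (zeroForcing? (path (suc m))) xs ,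
  filter-enumerates G k , filter-enumerates (path (suc m)) k ,
  subst₂ _≤_ (sym (length-filter≡count (zeroForcing? G) xs)) (sym (length-filter≡count (zeroForcing? (path (suc m))) xs))
         (zfCount≤zfCount-path simple cond k)
  where
  xs = subsetsOfSize (suc m) k
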